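{- Let $G=(V,E)$ be a directed graph, $s\neq t$ vertices and $k$ an integer with $1\le k\le 4$. Then the upper-bound graph equals the simple path graph: $SPG^u_k(s,t)=SPG_k(s,t)$; in particular, the edge set $E^u$ equals the edge set of $SPG_k(s,t)$.
   Context: A path from $x$ to $y$ is a vertex sequence $x=v_0,\ldots,v_l=y$ with $(v_{i-1},v_i)\in E$; its length is $l$ (length $0$ allowed); $V(p)$ is its vertex set; it is simple if its vertices are pairwise distinct. $P_l^\ast(x,y)$ is the set of simple paths from $x$ to $y$ of length at most $l$. $SPG_k(s,t)$ is the subgraph of $G$ formed by the union of vertices and edges of all simple $s$-$t$ paths of length at most $k$. Essential vertices: $EV_l^\ast(s,u)=\bigcap\{V(p): p\in P_l^\ast(s,u),\ t\notin V(p)\}$ and $EV_l^\ast(v,t)=\bigcap\{V(p): p\in P_l^\ast(v,t),\ s\notin V(p)\}$; $EV_l^\ast(s,u)$ exists iff some $p\in P_l^\ast(s,u)$ has $t\notin V(p)$, and $EV_l^\ast(v,t)$ exists iff some $p\in P_l^\ast(v,t)$ has $s\notin V(p)$. The upper-bound graph $SPG^u_k(s,t)=(V^u,E^u)$ is the subgraph of $G$ with $(u,v)\in E^u$ iff $(u,v)\in E$ and there exist nonnegative integers $k_f,k_b$ with $k_f+1+k_b\le k$ such that $EV^\ast_{k_f}(s,u)$ and $EV^\ast_{k_b}(v,t)$ exist and $EV^\ast_{k_f}(s,u)\cap EV^\ast_{k_b}(v,t)=\emptyset$; $V^u$ is the set of endpoints of edges in $E^u$. -}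

module Defs where

open import Level using (0ℓ)
open import Data.Nat using (ℕ; zero; suc; _≤_)
open import Data.Fin using (Fin)
open import Data.List using (List; []; _∷_)
open import Data.List.Membership.Propositional using (_∈_; _∉_)
open import Data.List.Relation.Unary.Unique.Propositional using (Unique)
open import Data.Product using (Σ; ∃; _×_; _,_)
open import Data.Sum using (_⊎_)
open import Relation.Nullary using (¬_)
open import Relation.Binary using (Rel; Decidable)

record Graph : Set₁ where
  field
    n     : ℕ
    Edge  : Rel (Fin n) 0ℓ
    edge? : Decidable Edge

module _ (G : Graph) where
  open Graph G

  V : Set
  V = Fin n

  data Path : V → V → ℕ → Set where
    [_]  : (x : V) → Path x x 0
    _∷ₚ_ : ∀ {x y z l} → Edge x y → Path y z l → Path x z (suc l)

  verts : ∀ {x y l} → Path x y l → List V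
  verts ([ x ])           = x ∷ []
  verts (_∷ₚ_ {x = x} _ p) = x ∷ verts p

  _∈V_ : ∀ {x y l} → V → Path x y l → Set
  w ∈V p = w ∈ verts p

  Simple : ∀ {x y l} → Path x y l → Set
  Simple p = Unique (verts p)

  data EdgeOf (u v : V) : ∀ {x y l} → Path x y l → Set where
    here  : ∀ {z l} (e : Edge u v) (p : Path v z l) → EdgeOf u v (e ∷ₚ p)
    there : ∀ {x y z l} (e : Edge x y) {p : Path y z l} → EdgeOf u v p → EdgeOf u v (e ∷ₚ p)

  record SPath (l : ℕ) (x y : V) : Set where
    constructor spath
    field
      len    : ℕ
      len≤   : len ≤ l
      path   : Path x y len
      simple : Simple path
  open SPath public

  module _ (s t : V) where

    SPGEdge : ℕ → V → V → Set
    SPGEdge k u v = Σ (SPath k s t) λ p → EdgeOf u v (path p)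

    SPGVertex : ℕ → V → Set
    SPGVertex k w = Σ (SPath k s t) λ p → w ∈V path p

    EVfExists : ℕ → V → Set
    EVfExists l u = Σ (SPath l s u) λ p → ¬ (t ∈V path p)

    -- membership in EV*_l(s,u) = ⋂ { V(p) : p ∈ P*_l(s,u), t ∉ V(p) }
    _∈EVf[_,_] : V → ℕ → V → Set
    w ∈EVf[ l , u ] = (p : SPath l s u) → ¬ (t ∈V path p) → w ∈V path p

    EVbExists : ℕ → V → Set
    EVbExists l v = Σ (SPath l v t) λ p → ¬ (s ∈V path p)

    _∈EVb[_,_] : V → ℕ → V → Set
    w ∈EVb[ l , v ] = (p : SPath l v t) → ¬ (s ∈V path p) → w ∈V path p

    UEdge : ℕ → V → V → Set
    UEdge k u v =
      Edge u v ×
      Σ ℕ λ kf → Σ ℕ λ kb →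
        (kf + 1 + kb ≤ k) ×
        EVfExists kf u × EVbExists kb v ×
        (∀ w → ¬ ((w ∈EVf[ kf , u ]) × (w ∈EVb[ kb , v ])))
      where open import Data.Nat using (_+_)

    UVertex : ℕ → V → Set
    UVertex k w = (Σ V λ v → UEdge k w v) ⊎ (Σ V λ u → UEdge k u w)

-- An edge (u, v) of SPG_k(s, t) splits its simple s-t path into disjoint simple
-- paths s ⇝ u and v ⇝ t, which witness (u, v) ∈ E^u. Conversely, from
-- kf + 1 + kb ≤ 4 one side, say kf, is at most 1, so the s-u witness has vertices
-- within {s, u}. It therefore suffices to find a simple v-t path of length ≤ kb
-- avoiding both s and u; if there were none, u would lie in EV*_kb(v, t) as well
-- as in EV*_kf(s, u), contradicting disjointness. Finite search over bounded paths
-- makes the existence of such a path decidable, so the argument is constructive.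
module Submission where

open import Defs
open import Data.Nat using (ℕ; zero; suc; _≤_; _+_; s≤s; _≤?_)
open import Data.Nat.Properties
  using (≤-refl; ≤-trans; ≤-pred; +-mono-≤; +-monoˡ-≤; +-assoc; ≰⇒>; anyUpTo?)
open import Data.Fin.Properties using (any?) renaming (_≟_ to _≟ᶠ_)
open import Data.List using (List; []; _∷_; _++_)
open import Data.List.Relation.Unary.Any using (here; there)
open import Data.List.Relation.Unary.All as All using ()
open import Data.List.Relation.Unary.All.Properties as All using ()
open import Data.List.Membership.Propositional using (_∈_; _∉_)
open import Data.List.Relation.Unary.Unique.Propositional using (Unique; []; _∷_)
open import Data.List.Relation.Unary.Unique.Propositional.Properties as Unique using ()
open import Data.List.Relation.Binary.Disjoint.Propositional using (Disjoint)
open import Data.List.Relation.Binary.Disjoint.Propositional.Properties as Disjoint using ()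
open import Data.Product using (Σ; _×_; _,_; map₂)
open import Data.Sum using (_⊎_; inj₁; inj₂) renaming (map to map-⊎)
open import Data.Empty using (⊥-elim)
open import Relation.Nullary using (yes; no)
open import Relation.Nullary.Decidable using (Dec; map′; _×-dec_; ¬?; decidable-stable)
open import Relation.Unary using (Decidable)
open import Relation.Binary.PropositionalEquality using (_≡_; _≢_; refl; sym; trans; cong; subst)
open import Function.Base using (_∘_)
open import Function.Bundles using (_⇔_; mk⇔; Equivalence)
open import Function.Properties.Equivalence using () renaming (trans to ⇔-trans; sym to ⇔-sym)

Unique-++⁻ : ∀ {A : Set} (xs : List A) {ys} →
             Unique (xs ++ ys) → Unique xs × Unique ys × Disjoint xs ys
Unique-++⁻ []       u = [] , u , λ ()
Unique-++⁻ (x ∷ xs) (x∉ ∷ u) with Unique-++⁻ xs u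
... | uxs , uys , disjoint = All.++⁻ˡ xs x∉ ∷ uxs , uys , λ where
  (here refl  , v∈ys) → All.lookup (All.++⁻ʳ xs x∉) v∈ys refl
  (there v∈xs , v∈ys) → disjoint (v∈xs , v∈ys)

one-side-≤1 : ∀ {m n} → m + 1 + n ≤ 4 → m ≤ 1 ⊎ n ≤ 1
one-side-≤1 {m} {n} m+1+n≤4 with m ≤? 1
... | yes m≤1 = inj₁ m≤1
... | no  m≰1 = inj₂ (≤-pred (≤-pred (≤-pred
                  (≤-trans (+-monoˡ-≤ n (+-monoˡ-≤ 1 (≰⇒> m≰1))) m+1+n≤4))))

module SimplePaths (G : Graph) where
  open Graph G
  open import Data.List.Membership.DecPropositional (_≟ᶠ_ {n}) using (_∈?_)
  open import Data.List.Relation.Unary.Unique.DecPropositional (_≟ᶠ_ {n}) using (unique?)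

  first∈verts : ∀ {x y l} (p : Path G x y l) → x ∈ verts G p
  first∈verts [ x ]    = here refl
  first∈verts (e ∷ₚ p) = here refl

  last∈verts : ∀ {x y l} (p : Path G x y l) → y ∈ verts G p
  last∈verts [ x ]    = here refl
  last∈verts (e ∷ₚ p) = there (last∈verts p)

  source∈verts : ∀ {x y l u v} {p : Path G x y l} → EdgeOf G u v p → u ∈ verts G p
  source∈verts (here e p)  = here refl
  source∈verts (there e r) = there (source∈verts r)

  target∈verts : ∀ {x y l u v} {p : Path G x y l} → EdgeOf G u v p → v ∈ verts G p
  target∈verts (here e p)  = there (first∈verts p)
  target∈verts (there e r) = there (target∈verts r)

  length0⇒≡ : ∀ {x y} → Path G x y 0 → x ≡ y
  length0⇒≡ [ x ] = refl

  ∈verts⇒endpoint : ∀ {x y l w} (p : Path G x y (suc l)) → w ∈ verts G p →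
                    (Σ (V G) λ v → EdgeOf G w v p) ⊎ (Σ (V G) λ u → EdgeOf G u w p)
  ∈verts⇒endpoint (e ∷ₚ q)              (here refl)         = inj₁ (_ , here e q)
  ∈verts⇒endpoint (e ∷ₚ [ y ])          (there (here refl)) = inj₂ (_ , here e [ y ])
  ∈verts⇒endpoint (e ∷ₚ q@(_ ∷ₚ _))     (there w∈q) =
    map-⊎ (map₂ (there e)) (map₂ (there e)) (∈verts⇒endpoint q w∈q)

  short-path-disjoint : ∀ {x y l} (p : Path G x y l) → l ≤ 1 → ∀ {ys} →
                        x ∉ ys → y ∉ ys → Disjoint (verts G p) ys
  short-path-disjoint [ x ]          _ x∉ _ (here refl , w∈ys)         = x∉ w∈ys
  short-path-disjoint (e ∷ₚ [ y ])   _ x∉ _ (here refl , w∈ys)         = x∉ w∈ys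
  short-path-disjoint (e ∷ₚ [ y ])   _ _ y∉ (there (here refl) , w∈ys) = y∉ w∈ys
  short-path-disjoint (e ∷ₚ (_ ∷ₚ _)) (s≤s ())

  _++⟨_⟩_ : ∀ {x u v y a b} → Path G x u a → Edge u v → Path G v y b → Path G x y (a + suc b)
  [ _ ]     ++⟨ e ⟩ q = e ∷ₚ q
  (e′ ∷ₚ p) ++⟨ e ⟩ q = e′ ∷ₚ (p ++⟨ e ⟩ q)

  verts-++⟨⟩ : ∀ {x u v y a b} (p : Path G x u a) (e : Edge u v) (q : Path G v y b) →
               verts G (p ++⟨ e ⟩ q) ≡ verts G p ++ verts G q
  verts-++⟨⟩ [ _ ]     e q = refl
  verts-++⟨⟩ (e′ ∷ₚ p) e q = cong (_ ∷_) (verts-++⟨⟩ p e q)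

  edgeOf-++⟨⟩ : ∀ {x u v y a b} (p : Path G x u a) (e : Edge u v) (q : Path G v y b) →
                EdgeOf G u v (p ++⟨ e ⟩ q)
  edgeOf-++⟨⟩ [ _ ]     e q = here e q
  edgeOf-++⟨⟩ (e′ ∷ₚ p) e q = there e′ (edgeOf-++⟨⟩ p e q)

  record SplitAt (u v : V G) {x y l} (p : Path G x y l) : Set where
    field
      {a b}   : ℕ
      front   : Path G x u a
      edge    : Edge u v
      back    : Path G v y b
      verts≡  : verts G p ≡ verts G front ++ verts G back
      length≡ : l ≡ a + suc b

  splitAt : ∀ {u v x y l} (p : Path G x y l) → EdgeOf G u v p → SplitAt u v p
  splitAt (e ∷ₚ q) (here .e .q) = record
    { front = [ _ ] ; edge = e ; back = q ; verts≡ = refl ; length≡ = refl }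
  splitAt (e ∷ₚ q) (there .e r) = record
    { front = e ∷ₚ front ; edge = edge ; back = back
    ; verts≡ = cong (_ ∷_) verts≡ ; length≡ = cong suc length≡ }
    where open SplitAt (splitAt q r)

  record Decomposition (k : ℕ) (x u v y : V G) : Set where
    constructor decomposition
    field
      {kf kb}  : ℕ
      bound    : kf + 1 + kb ≤ k
      front    : SPath G kf x u
      edge     : Edge u v
      back     : SPath G kb v y
      disjoint : Disjoint (verts G (path front)) (verts G (path back))

  decompose : ∀ {k x y u v} → (Σ (SPath G k x y) λ p → EdgeOf G u v (path p)) →
              Decomposition k x u v y
  decompose (spath _ l≤k p simple , r) = cut (splitAt p r) l≤k simple
    where
      cut : ∀ {k x y l u v} {p : Path G x y l} → SplitAt u v p → l ≤ k → Simple G p →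
            Decomposition k x u v y
      cut {k} record { a = a ; b = b ; front = front ; edge = e ; back = back
                     ; verts≡ = verts≡ ; length≡ = length≡ } l≤k simple
        with Unique-++⁻ (verts G front) (subst Unique verts≡ simple)
      ... | unique-front , unique-back , disjoint =
        decomposition (subst (_≤ k) (trans length≡ (sym (+-assoc a 1 b))) l≤k)
          (spath a ≤-refl front unique-front) e (spath b ≤-refl back unique-back) disjoint

  compose : ∀ {k x y u v} → Decomposition k x u v y →
            Σ (SPath G k x y) λ p → EdgeOf G u v (path p)
  compose {k} (decomposition {kf} {kb} bound
                (spath a a≤kf p simple-p) e (spath b b≤kb q simple-q) disjoint) =
    spath (a + suc b) a+1+b≤k (p ++⟨ e ⟩ q)
      (subst Unique (sym (verts-++⟨⟩ p e q)) (Unique.++⁺ simple-p simple-q disjoint)) ,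
    edgeOf-++⟨⟩ p e q
    where
      a+1+b≤k : a + suc b ≤ k
      a+1+b≤k = ≤-trans (+-mono-≤ a≤kf (s≤s b≤kb)) (subst (_≤ k) (+-assoc kf 1 kb) bound)

  paths? : {Q : List (V G) → Set} → Decidable Q →
           ∀ m x y → Dec (Σ (Path G x y m) λ p → Q (verts G p))
  paths? Q? zero x y with x ≟ᶠ y
  ... | no x≢y = no λ { ([ _ ] , _) → x≢y refl }
  ... | yes refl = map′ ([ x ] ,_) (λ { ([ _ ] , q) → q }) (Q? (x ∷ []))
  paths? Q? (suc m) x y =
    map′ (λ (z , e , p , q) → e ∷ₚ p , q) (λ { (e ∷ₚ p , q) → _ , e , p , q })
      (any? λ z → edge? x z ×-dec paths? (λ vs → Q? (x ∷ vs)) m z y)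

  simplePaths? : {Q : List (V G) → Set} → Decidable Q →
                 ∀ l x y → Dec (Σ (SPath G l x y) λ p → Q (verts G (path p)))
  simplePaths? Q? l x y =
    map′ (λ { (m , s≤s m≤l , p , simple , q) → spath m m≤l p simple , q })
         (λ (spath m m≤l p simple , q) → m , s≤s m≤l , p , simple , q)
         (anyUpTo? (λ m → paths? (λ vs → unique? vs ×-dec Q? vs) m x y) (suc l))

  -- The second alternative is w ∈ EV*_l(x, y), the paths being required to avoid a = t or a = s.
  avoiding-or-essential : ∀ l x y a w →
    (Σ (SPath G l x y) λ p → a ∉ verts G (path p) × w ∉ verts G (path p)) ⊎
    ((p : SPath G l x y) → a ∉ verts G (path p) → w ∈ verts G (path p))
  avoiding-or-essential l x y a w
    with simplePaths? (λ vs → ¬? (a ∈? vs) ×-dec ¬? (w ∈? vs)) l x y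
  ... | yes avoiding = inj₁ avoiding
  ... | no none = inj₂ λ p a∉p →
    decidable-stable (w ∈? verts G (path p)) λ w∉p → none (p , a∉p , w∉p)

  Endpoint : (V G → V G → Set) → V G → Set
  Endpoint R w = (Σ (V G) λ v → R w v) ⊎ (Σ (V G) λ u → R u w)

  Endpoint-⇔ : {R S : V G → V G → Set} → (∀ u v → R u v ⇔ S u v) →
               ∀ w → Endpoint R w ⇔ Endpoint S w
  Endpoint-⇔ R⇔S w = mk⇔
    (map-⊎ (map₂ (Equivalence.to (R⇔S _ _))) (map₂ (Equivalence.to (R⇔S _ _))))
    (map-⊎ (map₂ (Equivalence.from (R⇔S _ _))) (map₂ (Equivalence.from (R⇔S _ _))))

  module _ (s t : V G) where

    decomposition⇒uEdge : ∀ {k u v} → Decomposition k s u v t → UEdge G s t k u v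
    decomposition⇒uEdge (decomposition {kf} {kb} bound front e back disjoint) =
      e , kf , kb , bound , (front , t∉front) , (back , s∉back) ,
      λ w (w∈EVf , w∈EVb) → disjoint (w∈EVf front t∉front , w∈EVb back s∉back)
      where
        t∉front : t ∉ verts G (path front)
        t∉front t∈front = disjoint (t∈front , last∈verts (path back))

        s∉back : s ∉ verts G (path back)
        s∉back s∈back = disjoint (first∈verts (path front) , s∈back)

    uEdge⇒decomposition : ∀ {k u v} → k ≤ 4 → UEdge G s t k u v → Decomposition k s u v t
    uEdge⇒decomposition {u = u} {v} k≤4
                        (e , kf , kb , bound , (front , _) , (back , _) , EV-disjoint)
      with one-side-≤1 (≤-trans bound k≤4)
    ... | inj₁ kf≤1 with avoiding-or-essential kb v t s u
    ...   | inj₁ (back′ , s∉back′ , u∉back′) = decomposition bound front e back′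
            (short-path-disjoint (path front) (≤-trans (len≤ front) kf≤1) s∉back′ u∉back′)
    ...   | inj₂ u∈EVb = ⊥-elim (EV-disjoint u ((λ p _ → last∈verts (path p)) , u∈EVb))
    uEdge⇒decomposition {u = u} {v} k≤4
                        (e , kf , kb , bound , (front , _) , (back , _) , EV-disjoint)
        | inj₂ kb≤1 with avoiding-or-essential kf s u t v
    ...   | inj₁ (front′ , t∉front′ , v∉front′) = decomposition bound front′ e back
            (Disjoint.sym
              (short-path-disjoint (path back) (≤-trans (len≤ back) kb≤1) v∉front′ t∉front′))
    ...   | inj₂ v∈EVf = ⊥-elim (EV-disjoint v (v∈EVf , λ p _ → first∈verts (path p)))

    spgVertex⇔endpoint : s ≢ t → ∀ k w → SPGVertex G s t k w ⇔ Endpoint (SPGEdge G s t k) w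
    spgVertex⇔endpoint s≢t k w = mk⇔ to from
      where
        to : SPGVertex G s t k w → Endpoint (SPGEdge G s t k) w
        to (spath zero    _ p _ , _)   = ⊥-elim (s≢t (length0⇒≡ p))
        to (spath (suc l) l≤k p simple , w∈p) =
          map-⊎ (map₂ (spath (suc l) l≤k p simple ,_)) (map₂ (spath (suc l) l≤k p simple ,_))
            (∈verts⇒endpoint p w∈p)

        from : Endpoint (SPGEdge G s t k) w → SPGVertex G s t k w
        from (inj₁ (_ , p , r)) = p , source∈verts r
        from (inj₂ (_ , p , r)) = p , target∈verts r

theorem8 : (G : Graph) (s t : V G) → s ≢ t → (k : ℕ) → 1 ≤ k → k ≤ 4 →
    ((u v : V G) → UEdge G s t k u v ⇔ SPGEdge G s t k u v) ×
    ((w : V G) → UVertex G s t k w ⇔ SPGVertex G s t k w)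
theorem8 G s t s≢t k _ k≤4 = edges , vertices
  where
    open SimplePaths G

    edges : ∀ u v → UEdge G s t k u v ⇔ SPGEdge G s t k u v
    edges u v = mk⇔ (compose ∘ uEdge⇒decomposition s t k≤4)
                    (decomposition⇒uEdge s t ∘ decompose)

    vertices : ∀ w → UVertex G s t k w ⇔ SPGVertex G s t k w
    vertices w = ⇔-trans (Endpoint-⇔ edges w) (⇔-sym (spgVertex⇔endpoint s t s≢t k w))
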